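{- Let $n\ge 2$ and let $(K_n,\mathcal{D})$ be a decomposition of the complete graph $K_n$ into complete subgraphs. Suppose $(K_n,\mathcal{D})$ is an arithmetic decomposition with different central vertices. Then $\chi'((K_n,\mathcal{D}))\le n$.
   Context: A decomposition $(K_n,\mathcal{D})$ is a collection $\mathcal{D}$ of complete subgraphs of $K_n$, each with at least two vertices, such that every edge of $K_n$ belongs to exactly one member of $\mathcal{D}$. A $k$-$\mathcal{D}$-coloring is a surjective map $\varphi':\mathcal{D}\to\{1,\dots,k\}$ such that for all distinct $G,H\in\mathcal{D}$ with $V(G)\cap V(H)\neq\emptyset$ we have $\varphi'(G)\neq\varphi'(H)$ (all edges of $G$ receive color $\varphi'(G)$). The chromatic index $\chi'((K_n,\mathcal{D}))$ is the least $k$ for which a $k$-$\mathcal{D}$-coloring exists. A subset $W=\{w_1,\dots,w_r\}$ of $\mathbb{Z}_n$ is $k$-arithmetic, for some $k\in\{1,\dots,\lfloor n/2\rfloor\}$, if its elements can be listed as $w_1,\dots,w_r$ with $w_{i+1}-w_i\equiv k \pmod n$ for $i=1,\dots,r-1$. $(K_n,\mathcal{D})$ is an arithmetic decomposition if there is a bijection $\varphi:V(K_n)\to\mathbb{Z}_n$ (an arithmetic labeling; vertices are identified with their labels) such that for every $G\in\mathcal{D}$ there is some $k\in\{1,\dots,\lfloor n/2\rfloor\}$ for which either $V(G)$ is $k$-arithmetic, or $V(G)$ can be partitioned into two $k$-arithmetic sets of the same cardinality. If $G\in\mathcal{D}$ has an odd number $l$ of vertices (so $V(G)$ is $k$-arithmetic),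 listed as $v_1,\dots,v_l$ with $v_{i+1}-v_i\equiv k\pmod n$, the vertex $v_{(l+1)/2}$ is the central vertex of $G$. The decomposition has different central vertices if any two distinct members of $\mathcal{D}$ of odd order have different central vertices. -}

module Defs where

open import Data.Nat using (ℕ; _+_; _≤_; _%_; _/_)
open import Data.Fin using (Fin; toℕ)
open import Data.Fin.Subset using (Subset; _∈_; ∣_∣)
open import Data.List using (List; _∷_; length; drop; _++_)
open import Data.List.Membership.Propositional renaming (_∈_ to _∈ₗ_)
open import Data.List.Relation.Unary.Unique.Propositional using (Unique)
open import Data.List.Relation.Unary.Linked using (Linked)
open import Data.Product using (Σ; ∃; _×_; ∃-syntax)
open import Data.Sum using (_⊎_)
open import Data.Empty using (⊥)
open import Function.Bundles using (_⇔_)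
open import Function.Definitions using (Surjective)
open import Relation.Binary.PropositionalEquality using (_≡_; _≢_)
open import Relation.Nullary using (¬_)

-- Vertices of K_n are Fin n; a member of 𝒟 is given by its vertex set.
-- A family 𝒟 of m complete subgraphs is  D : Fin m → Subset n.

IsDecomposition : (n m : ℕ) → (Fin m → Subset n) → Set
IsDecomposition n m D =
  (∀ i → 2 ≤ ∣ D i ∣) ×
  (∀ (u v : Fin n) → u ≢ v →
     (∃[ i ] (u ∈ D i × v ∈ D i)) ×
     (∀ i j → u ∈ D i → v ∈ D i → u ∈ D j → v ∈ D j → i ≡ j))

IsDColoring : (n m k : ℕ) → (Fin m → Subset n) → (Fin m → Fin k) → Set
IsDColoring n m k D c =
  Surjective _≡_ _≡_ c ×
  (∀ i j → i ≢ j → (∃[ v ] (v ∈ D i × v ∈ D j)) → c i ≢ c j)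

-- Step relation for a listing: label of the next vertex ≡ label of previous + k (mod n).
-- Since labels are < n and (where used) k ≤ n/2 < n, the congruence
-- b ≡ a + k (mod n) amounts to  b = a + k  or  b + n = a + k.
Step : (n k : ℕ) → (Fin n → Fin n) → Fin n → Fin n → Set
Step n k φ a b = (toℕ (φ b) ≡ toℕ (φ a) + k) ⊎ (toℕ (φ b) + n ≡ toℕ (φ a) + k)

ArithList : (n k : ℕ) → (Fin n → Fin n) → List (Fin n) → Set
ArithList n k φ ws = Unique ws × Linked (Step n k φ) ws

data ArithForm (n : ℕ) (φ : Fin n → Fin n) (S : Subset n) : Set where
  single : (k : ℕ) → 1 ≤ k → k ≤ n / 2 → (ws : List (Fin n)) →
           ArithList n k φ ws → (∀ v → (v ∈ S) ⇔ (v ∈ₗ ws)) →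
           ArithForm n φ S
  split  : (k : ℕ) → 1 ≤ k → k ≤ n / 2 → (ws₁ ws₂ : List (Fin n)) →
           ArithList n k φ ws₁ → ArithList n k φ ws₂ →
           Unique (ws₁ ++ ws₂) → length ws₁ ≡ length ws₂ →
           (∀ v → (v ∈ S) ⇔ (v ∈ₗ ws₁ ⊎ v ∈ₗ ws₂)) →
           ArithForm n φ S

-- v is the central vertex of an odd-order member with the given arithmetic listing
-- v_1,…,v_l :  v = v_{(l+1)/2}, i.e. the element at 0-based position ⌊l/2⌋.
IsCentral : ∀ {n φ S} → ArithForm n φ S → Fin n → Set
IsCentral (single k _ _ ws _ _) v =
  (length ws % 2 ≡ 1) × ∃[ rest ] (drop (length ws / 2) ws ≡ v ∷ rest)
IsCentral (split _ _ _ _ _ _ _ _ _ _) v = ⊥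

ArithDiffCentral : (n m : ℕ) → (Fin m → Subset n) → Set
ArithDiffCentral n m D =
  Σ (Fin n → Fin n) λ φ →
    Function.Definitions.Bijective _≡_ _≡_ φ ×
    Σ ((i : Fin m) → ArithForm n φ (D i)) λ w →
      ∀ i j v → i ≢ j → IsCentral (w i) v → ¬ IsCentral (w j) v

ChromIndexLE : (n m : ℕ) → (Fin m → Subset n) → ℕ → Set
ChromIndexLE n m D b = ∃[ k ] (k ≤ b × Σ (Fin m → Fin k) (IsDColoring n m k D))

-- Colour a member G by s_G, the sum of the labels of the two ends of its arithmetic listing(s),
-- taken mod n. Labels at mirror positions of a listing sum to s_G mod n, so in G the vertex v has
-- a partner u with v + u ≡ s_G. If G ≠ H share v and s_G ≡ s_H, then v has the same partner u in
-- both: u ≠ v would put the edge uv in two members, and u = v makes v the central vertex of both.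
module Submission where

open import Defs
open import Data.Nat using (ℕ; zero; suc; _+_; _*_; _∸_; _≤_; _<_; _%_; _/_; NonZero; >-nonZero; z≤n; s≤s; s≤s⁻¹)
open import Data.Nat.Properties
open import Data.Nat.DivMod
open import Data.Fin using (Fin; toℕ; cast; opposite) renaming (zero to fzero; suc to fsuc)
open import Data.Fin.Properties using (toℕ<n; toℕ-injective; toℕ-fromℕ<; toℕ-cast; opposite-prop; any?; injective⇒≤)
  renaming (_≟_ to _≟ᶠ_)
open import Data.Fin.Subset using (Subset; _∈_)
open import Data.List using (List; []; _∷_; length; lookup; drop; _++_)
open import Data.List.Membership.Propositional using () renaming (_∈_ to _∈ₗ_)
open import Data.List.Membership.Propositional.Properties using (∈-lookup; ∈-++⁺ʳ)
open import Data.List.Relation.Unary.Any using (here; there; index)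
open import Data.List.Relation.Unary.Any.Properties using (lookup-index)
open import Data.List.Relation.Unary.All as All using ()
open import Data.List.Relation.Unary.AllPairs using (_∷_)
open import Data.List.Relation.Unary.Unique.Propositional using (Unique)
open import Data.List.Relation.Unary.Linked using (Linked; _∷_)
open import Data.Product using (_×_; _,_; ∃-syntax; proj₂)
open import Data.Sum using (inj₁; inj₂)
open import Data.Empty using (⊥; ⊥-elim)
open import Function.Bundles using (Equivalence)
open import Function.Definitions using (Surjective; Injective)
open import Relation.Binary.PropositionalEquality
open import Relation.Nullary using (Dec; yes; no)
open import Data.Nat.Solver using (module +-*-Solver)

record ImageFactorisation {m n : ℕ} (f : Fin m → Fin n) : Set where
  field
    size            : ℕ
    onto            : Fin m → Fin size
    into            : Fin size → Fin n
    onto-surjective : Surjective _≡_ _≡_ onto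
    into-injective  : Injective _≡_ _≡_ into
    factorises      : ∀ i → into (onto i) ≡ f i

imageFactorisation : ∀ {m n} (f : Fin m → Fin n) → ImageFactorisation f
imageFactorisation {zero} f =
  record { size = 0 ; onto = λ () ; into = λ () ; onto-surjective = λ ()
         ; into-injective = λ { {()} } ; factorises = λ () }
imageFactorisation {suc m} f with imageFactorisation (λ i → f (fsuc i))
... | F with any? (λ c → ImageFactorisation.into F c ≟ᶠ f fzero)
...   | yes (c , into-c) = record
  { size = size ; onto = onto′ ; into = into ; into-injective = into-injective
  ; onto-surjective = surjective ; factorises = factorises′ }
  where
  open ImageFactorisation F
  onto′ : Fin (suc m) → Fin size
  onto′ fzero    = c
  onto′ (fsuc i) = onto i
  surjective : Surjective _≡_ _≡_ onto′
  surjective c′ with onto-surjective c′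
  ... | i , onto-i = fsuc i , λ { refl → onto-i refl }
  factorises′ : ∀ i → into (onto′ i) ≡ f i
  factorises′ fzero    = into-c
  factorises′ (fsuc i) = factorises i
...   | no f0∉image = record
  { size = suc size ; onto = onto′ ; into = into′ ; into-injective = injective
  ; onto-surjective = surjective ; factorises = factorises′ }
  where
  open ImageFactorisation F
  onto′ : Fin (suc m) → Fin (suc size)
  onto′ fzero    = fzero
  onto′ (fsuc i) = fsuc (onto i)
  into′ : Fin (suc size) → Fin _
  into′ fzero    = f fzero
  into′ (fsuc c) = into c
  injective : Injective _≡_ _≡_ into′
  injective {fzero}  {fzero}  _ = refl
  injective {fzero}  {fsuc d} e = ⊥-elim (f0∉image (d , sym e))
  injective {fsuc c} {fzero}  e = ⊥-elim (f0∉image (c , e))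
  injective {fsuc c} {fsuc d} e = cong fsuc (into-injective e)
  surjective : Surjective _≡_ _≡_ onto′
  surjective fzero     = fzero , λ { refl → refl }
  surjective (fsuc c′) with onto-surjective c′
  ... | i , onto-i = fsuc i , λ { refl → cong fsuc (onto-i refl) }
  factorises′ : ∀ i → into′ (onto′ i) ≡ f i
  factorises′ fzero    = refl
  factorises′ (fsuc i) = factorises i

properColouring⇒chromIndex≤ : ∀ {n m b} {D : Fin m → Subset n} (f : Fin m → Fin b) →
  (∀ i j → i ≢ j → (∃[ v ] (v ∈ D i × v ∈ D j)) → f i ≢ f j) →
  ChromIndexLE n m D b
properColouring⇒chromIndex≤ f proper =
  size , injective⇒≤ into-injective , onto , onto-surjective ,
  λ i j i≢j shared same → proper i j i≢j shared
    (trans (sym (factorises i)) (trans (cong into same) (factorises j)))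
  where open ImageFactorisation (imageFactorisation f)

module _ {A : Set} where

  lookup-injective : ∀ {xs : List A} → Unique xs → ∀ {i j} → lookup xs i ≡ lookup xs j → i ≡ j
  lookup-injective (_   ∷ _) {fzero}  {fzero}  _ = refl
  lookup-injective (x∉ ∷ _) {fzero}  {fsuc j} e = ⊥-elim (All.lookup x∉ (∈-lookup j) e)
  lookup-injective (x∉ ∷ _) {fsuc i} {fzero}  e = ⊥-elim (All.lookup x∉ (∈-lookup i) (sym e))
  lookup-injective (_   ∷ u) {fsuc i} {fsuc j} e = cong fsuc (lookup-injective u e)

  unique-++⇒disjoint : ∀ xs {ys} {v : A} → Unique (xs ++ ys) → v ∈ₗ xs → v ∈ₗ ys → ⊥
  unique-++⇒disjoint (_ ∷ xs) (x∉ ∷ _) (here refl) v∈ys = All.lookup x∉ (∈-++⁺ʳ xs v∈ys) refl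
  unique-++⇒disjoint (_ ∷ xs) (_  ∷ u) (there v∈xs) v∈ys = unique-++⇒disjoint xs u v∈xs v∈ys

  drop-lookup : ∀ (xs : List A) i → drop (toℕ i) xs ≡ lookup xs i ∷ drop (suc (toℕ i)) xs
  drop-lookup (_ ∷ _)  fzero    = refl
  drop-lookup (_ ∷ xs) (fsuc i) = drop-lookup xs i

odd-%2 : ∀ i → suc (i + i) % 2 ≡ 1
odd-%2 zero    = refl
odd-%2 (suc i) rewrite +-suc i i = odd-%2 i

odd-/2 : ∀ i → suc (i + i) / 2 ≡ i
odd-/2 zero    = refl
odd-/2 (suc i) rewrite +-suc i i =
  trans (m/n≡1+[m∸n]/n {suc (suc (suc (i + i)))} {2} (s≤s (s≤s z≤n))) (cong suc (odd-/2 i))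

middle-lookup : ∀ {A : Set} (xs : List A) i → length xs ≡ suc (toℕ i + toℕ i) →
  (length xs % 2 ≡ 1) × ∃[ rest ] (drop (length xs / 2) xs ≡ lookup xs i ∷ rest)
middle-lookup xs i odd rewrite odd =
  odd-%2 (toℕ i) , drop (suc (toℕ i)) xs ,
  trans (cong (λ h → drop h xs) (odd-/2 (toℕ i))) (drop-lookup xs i)

mirror : ∀ {l l′} → l ≡ l′ → Fin (suc l) → Fin (suc l′)
mirror eq i = cast (cong suc eq) (opposite i)

toℕ-mirror : ∀ {l l′} (eq : l ≡ l′) i → toℕ i + toℕ (mirror eq i) ≡ l
toℕ-mirror eq i = begin
  toℕ i + toℕ (mirror eq i) ≡⟨ cong (toℕ i +_) (trans (toℕ-cast _ (opposite i)) (opposite-prop i)) ⟩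
  toℕ i + (_ ∸ toℕ i)       ≡⟨ m+[n∸m]≡n (s≤s⁻¹ (toℕ<n i)) ⟩
  _                         ∎
  where open ≡-Reasoning

module Modular (n : ℕ) .{{_ : NonZero n}} where

  +-cong-% : ∀ {a a′ b b′} → a % n ≡ a′ % n → b % n ≡ b′ % n → (a + b) % n ≡ (a′ + b′) % n
  +-cong-% {a} {a′} {b} {b′} a≡a′ b≡b′ = begin
    (a + b) % n             ≡⟨ %-distribˡ-+ a b n ⟩
    (a % n + b % n) % n     ≡⟨ cong₂ (λ x y → (x + y) % n) a≡a′ b≡b′ ⟩
    (a′ % n + b′ % n) % n   ≡⟨ %-distribˡ-+ a′ b′ n ⟨
    (a′ + b′) % n           ∎
    where open ≡-Reasoning

  +-inverse-% : ∀ a {x} → x < n → (n ∸ a % n + (a + x)) % n ≡ x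
  +-inverse-% a {x} x<n = begin
    (n ∸ a % n + (a + x)) % n       ≡⟨ +-cong-% {n ∸ a % n} refl (+-cong-% (m%n%n≡m%n a n) refl) ⟨
    (n ∸ a % n + (a % n + x)) % n   ≡⟨ cong (_% n) (+-assoc (n ∸ a % n) (a % n) x) ⟨
    (n ∸ a % n + a % n + x) % n     ≡⟨ cong (λ h → (h + x) % n) (m∸n+n≡m (m%n≤n a n)) ⟩
    (n + x) % n                     ≡⟨ cong (_% n) (+-comm n x) ⟩
    (x + n) % n                     ≡⟨ [m+n]%n≡m%n x n ⟩
    x % n                           ≡⟨ m<n⇒m%n≡m x<n ⟩
    x                               ∎
    where open ≡-Reasoning

  +-cancelˡ-% : ∀ a {x y} → x < n → y < n → (a + x) % n ≡ (a + y) % n → x ≡ y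
  +-cancelˡ-% a x<n y<n e = trans (sym (+-inverse-% a x<n))
    (trans (+-cong-% {n ∸ a % n} refl e) (+-inverse-% a y<n))

  mod≡⇒%≡ : ∀ {a b} → a mod n ≡ b mod n → a % n ≡ b % n
  mod≡⇒%≡ {a} {b} e = trans (sym (toℕ-fromℕ< (m%n<n a n))) (trans (cong toℕ e) (toℕ-fromℕ< (m%n<n b n)))

module Arithmetic (n : ℕ) .{{_ : NonZero n}} (φ : Fin n → Fin n) where

  open Modular n

  val : Fin n → ℕ
  val v = toℕ (φ v)

  step-% : ∀ {k a b} → Step n k φ a b → val b % n ≡ (val a + k) % n
  step-% (inj₁ e)         = cong (_% n) e
  step-% {b = b} (inj₂ e) = trans (sym ([m+n]%n≡m%n (val b) n)) (cong (_% n) e)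

  lookup-% : ∀ {k x xs} → Linked (Step n k φ) (x ∷ xs) →
    ∀ i → val (lookup (x ∷ xs) i) % n ≡ (val x + toℕ i * k) % n
  lookup-% {x = x} _ fzero = cong (_% n) (sym (+-identityʳ (val x)))
  lookup-% {k} {x} {y ∷ ys} (step ∷ linked) (fsuc i) = begin
    val (lookup (y ∷ ys) i) % n ≡⟨ lookup-% linked i ⟩
    (val y + toℕ i * k) % n     ≡⟨ +-cong-% (step-% step) refl ⟩
    (val x + k + toℕ i * k) % n ≡⟨ cong (_% n) (+-assoc (val x) k (toℕ i * k)) ⟩
    (val x + suc (toℕ i) * k) % n ∎
    where open ≡-Reasoning

  -- For k-arithmetic listings of equal length this is, mod n, the label of the first vertex of xs
  -- plus that of the last vertex of ys; the junk value 0 is never used, as members are nonempty.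
  endpointSum : ℕ → List (Fin n) → List (Fin n) → ℕ
  endpointSum k (x ∷ xs) (y ∷ _) = val x + val y + length xs * k
  endpointSum _ _        _       = 0

  endpointSum-comm : ∀ k {x y xs ys} → length xs ≡ length ys →
    endpointSum k (x ∷ xs) (y ∷ ys) ≡ endpointSum k (y ∷ ys) (x ∷ xs)
  endpointSum-comm k {x} {y} eq = cong₂ (λ s l → s + l * k) (+-comm (val x) (val y)) eq

  mirror-sum : ∀ {k x y xs ys} → Linked (Step n k φ) (x ∷ xs) → Linked (Step n k φ) (y ∷ ys) →
    (eq : length xs ≡ length ys) → ∀ i →
    (val (lookup (x ∷ xs) i) + val (lookup (y ∷ ys) (mirror eq i))) % n ≡ endpointSum k (x ∷ xs) (y ∷ ys) % n
  mirror-sum {k} {x} {y} {xs} {ys} lx ly eq i = begin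
    (val (lookup (x ∷ xs) i) + val (lookup (y ∷ ys) j)) % n ≡⟨ +-cong-% (lookup-% lx i) (lookup-% ly j) ⟩
    (val x + toℕ i * k + (val y + toℕ j * k)) % n ≡⟨ cong (_% n) (+-*-Solver.solve 5
      (λ X Y I J K → X :+ I :* K :+ (Y :+ J :* K) := X :+ Y :+ (I :+ J) :* K)
      refl (val x) (val y) (toℕ i) (toℕ j) k) ⟩
    (val x + val y + (toℕ i + toℕ j) * k) % n  ≡⟨ cong (λ l → (val x + val y + l * k) % n) (toℕ-mirror eq i) ⟩
    (val x + val y + length xs * k) % n        ∎
    where
    open ≡-Reasoning
    open +-*-Solver using (_:+_; _:*_; _:=_)
    j = mirror eq i

  mirror-partner-sum : ∀ {k x y xs ys v} → Linked (Step n k φ) (x ∷ xs) → Linked (Step n k φ) (y ∷ ys) →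
    (eq : length xs ≡ length ys) (v∈xs : v ∈ₗ x ∷ xs) →
    (val v + val (lookup (y ∷ ys) (mirror eq (index v∈xs)))) % n ≡ endpointSum k (x ∷ xs) (y ∷ ys) % n
  mirror-partner-sum {k} {x} {y} {xs} {ys} lx ly eq v∈xs =
    subst (λ u → (val u + val (lookup (y ∷ ys) j)) % n ≡ endpointSum k (x ∷ xs) (y ∷ ys) % n)
      (sym (lookup-index v∈xs)) (mirror-sum lx ly eq (index v∈xs))
    where j = mirror eq (index v∈xs)

  colour : ∀ {S} → ArithForm n φ S → ℕ
  colour (single k _ _ ws _ _)           = endpointSum k ws ws
  colour (split k _ _ ws₁ ws₂ _ _ _ _ _) = endpointSum k ws₁ ws₂

  record Partner {S} (w : ArithForm n φ S) (v : Fin n) : Set where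
    field
      vertex        : Fin n
      vertex∈S      : vertex ∈ S
      sum≡colour    : (val v + val vertex) % n ≡ colour w % n
      self⇒central  : vertex ≡ v → IsCentral w v

  partner : ∀ {S} (w : ArithForm n φ S) {v} → v ∈ S → Partner w v
  partner (single _ _ _ [] _ iff) {v} v∈S with Equivalence.to (iff v) v∈S
  ... | ()
  partner w@(single _ _ _ ws@(_ ∷ xs) (unique , linked) iff) {v} v∈S = record
    { vertex       = lookup ws j
    ; vertex∈S     = Equivalence.from (iff _) (∈-lookup j)
    ; sum≡colour   = mirror-partner-sum linked linked refl v∈ws
    ; self⇒central = central
    }
    where
    v∈ws = Equivalence.to (iff v) v∈S
    i = index v∈ws
    j = mirror refl i
    central : lookup ws j ≡ v → IsCentral w v
    central e = subst (IsCentral w) (sym (lookup-index v∈ws))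
      (middle-lookup ws i (cong suc (sym (subst (λ j → toℕ i + toℕ j ≡ length xs) j≡i (toℕ-mirror refl i)))))
      where
      j≡i : j ≡ i
      j≡i = lookup-injective unique (trans e (lookup-index v∈ws))
  partner (split _ _ _ [] [] _ _ _ _ iff) {v} v∈S with Equivalence.to (iff v) v∈S
  ... | inj₁ ()
  ... | inj₂ ()
  partner (split _ _ _ [] (_ ∷ _) _ _ _ () _) _
  partner (split _ _ _ (_ ∷ _) [] _ _ _ () _) _
  partner (split k _ _ ws₁@(_ ∷ xs) ws₂@(_ ∷ ys) (_ , l₁) (_ , l₂) unique eq iff) {v} v∈S
    with Equivalence.to (iff v) v∈S
  ... | inj₁ v∈ws₁ = record
    { vertex       = lookup ws₂ j
    ; vertex∈S     = Equivalence.from (iff _) (inj₂ (∈-lookup j))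
    ; sum≡colour   = mirror-partner-sum l₁ l₂ (suc-injective eq) v∈ws₁
    ; self⇒central = λ e → unique-++⇒disjoint ws₁ unique v∈ws₁ (subst (_∈ₗ ws₂) e (∈-lookup j))
    }
    where j = mirror (suc-injective eq) (index v∈ws₁)
  ... | inj₂ v∈ws₂ = record
    { vertex       = lookup ws₁ j
    ; vertex∈S     = Equivalence.from (iff _) (inj₁ (∈-lookup j))
    ; sum≡colour   = trans (mirror-partner-sum l₂ l₁ (sym (suc-injective eq)) v∈ws₂)
                       (cong (_% n) (endpointSum-comm k {xs = ys} {ys = xs} (sym (suc-injective eq))))
    ; self⇒central = λ e → unique-++⇒disjoint ws₁ unique (subst (_∈ₗ ws₁) e (∈-lookup j)) v∈ws₂
    }
    where j = mirror (sym (suc-injective eq)) (index v∈ws₂)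

  open Partner

  partner-unique : Injective _≡_ _≡_ φ → ∀ {S T} {w : ArithForm n φ S} {w′ : ArithForm n φ T} {v}
    (P : Partner w v) (P′ : Partner w′ v) → colour w mod n ≡ colour w′ mod n → vertex P ≡ vertex P′
  partner-unique φ-injective {v = v} P P′ same-colour = φ-injective (toℕ-injective
    (+-cancelˡ-% (val v) (toℕ<n (φ (vertex P))) (toℕ<n (φ (vertex P′)))
      (trans (sum≡colour P) (trans (mod≡⇒%≡ same-colour) (sym (sum≡colour P′))))))

theorem1 : (n : ℕ) → 2 ≤ n → (m : ℕ) → (D : Fin m → Subset n) →
    IsDecomposition n m D → ArithDiffCentral n m D → ChromIndexLE n m D n
theorem1 n 2≤n m D (_ , edge-in-unique-member) (φ , (φ-injective , _) , w , distinct-centres) =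
  properColouring⇒chromIndex≤ (λ i → colour (w i) mod n) proper
  where
  instance
    n-nonZero : NonZero n
    n-nonZero = >-nonZero (≤-trans (s≤s z≤n) 2≤n)
  open Arithmetic n φ
  open Partner
  proper : ∀ i j → i ≢ j → (∃[ v ] (v ∈ D i × v ∈ D j)) → colour (w i) mod n ≢ colour (w j) mod n
  proper i j i≢j (v , v∈Dᵢ , v∈Dⱼ) same-colour = refute (vertex Pᵢ ≟ᶠ v)
    where
    Pᵢ = partner (w i) v∈Dᵢ
    Pⱼ = partner (w j) v∈Dⱼ
    same-partner : vertex Pᵢ ≡ vertex Pⱼ
    same-partner = partner-unique φ-injective Pᵢ Pⱼ same-colour
    refute : Dec (vertex Pᵢ ≡ v) → ⊥
    refute (yes u≡v) = distinct-centres i j v i≢j (self⇒central Pᵢ u≡v)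
      (self⇒central Pⱼ (trans (sym same-partner) u≡v))
    refute (no u≢v) = i≢j (proj₂ (edge-in-unique-member (vertex Pᵢ) v u≢v) i j (vertex∈S Pᵢ) v∈Dᵢ
      (subst (_∈ D j) (sym same-partner) (vertex∈S Pⱼ)) v∈Dⱼ)
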